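{- For all integers $n\ge 0$ and $h\ge 0$, $|\mathcal{B}_{n,h}|=|\mathcal{D}_{n,h}|$, where $\mathcal{B}_{n,h}$ is the set of full binary trees with $n$ internal vertices and refined Horton--Strahler number $h$, and $\mathcal{D}_{n,h}$ is the set of Dyck paths of length $2n$ with height $h$.
   Context: Let $\mathcal{U}=\{1,2\}^*$ be the set of finite words over $\{1,2\}$ (including the empty word $\emptyset$); $uv$ or $u\star v$ denotes concatenation, $uV=\{uv:v\in V\}$. A binary tree is a finite set $\mathrm{t}\subset\mathcal{U}$ containing $\emptyset$ and closed under taking prefixes (if $u_1\dots u_\ell\in\mathrm{t}$ then $u_1\dots u_{\ell-1}\in\mathrm{t}$). A vertex $v$ is internal if $v1\in\mathrm{t}$ or $v2\in\mathrm{t}$. The tree is full if for all $u\in\mathrm{t}$, $u1\in\mathrm{t}\iff u2\in\mathrm{t}$. Let $\preceq_{\mathrm{lex}}$ be the lexicographic order on $\mathcal{U}$ and $u\wedge v$ the longest common prefix of $u,v$. An embedding of a tree $\mathrm{t}$ in a tree $\mathrm{t}'$ is an injective map $\varphi:\mathrm{t}\to\mathrm{t}'$ that is strictly increasing for $\preceq_{\mathrm{lex}}$ and satisfies $\varphi(u\wedge v)=\varphi(u)\wedge\varphi(v)$ for all $u,v\in\mathrm{t}$. Define trees $\tau_0=\{\emptyset\}$, $\tau_1=\{\emptyset,1,2\}$, and for $m\ge1$: $\tau_{2m}=\{\emptyset\}\cup 1\tau_m\cup 2\tau_{m-1}$, $\tau_{2m+1}=\{\emptyset\}\cup 1\tau_m\cup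 2\tau_m$. The refined Horton--Strahler number of a binary tree $\mathrm{t}$ is $\mathcal{S}(\mathrm{t})=\max\{r:\tau_r\text{ can be embedded in }\mathrm{t}\}$. A Dyck path of length $2n$ is a function $\mathrm{d}:\{0,\dots,2n\}\to\mathbb{Z}_{\ge0}$ with $\mathrm{d}(0)=\mathrm{d}(2n)=0$ and $|\mathrm{d}(i)-\mathrm{d}(i-1)|=1$ for $1\le i\le 2n$; its height is $\|\mathrm{d}\|=\max_i\mathrm{d}(i)$. -}

module Defs where

open import Data.Nat using (ℕ; zero; suc; _+_; _*_; _∸_; _≤_; _⊔_; ⌊_/2⌋)
open import Data.Bool using (Bool; true; false; if_then_else_)
open import Data.List using (List; []; _∷_; foldr)
open import Data.Vec using (Vec; lookup; toList; head; last)
open import Data.Fin using (Fin; inject₁) renaming (suc to fsuc; zero to fzero)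
open import Data.Product using (Σ; ∃; _×_; _,_)
open import Data.Sum using (_⊎_)
open import Relation.Binary.PropositionalEquality using (_≡_)
open import Relation.Nullary using (¬_)

data Dir : Set where
  d1 d2 : Dir

Word : Set
Word = List Dir

data _<lex_ : Word → Word → Set where
  nil<cons : ∀ {a v} → [] <lex (a ∷ v)
  1<2      : ∀ {u v} → (d1 ∷ u) <lex (d2 ∷ v)
  step     : ∀ {a u v} → u <lex v → (a ∷ u) <lex (a ∷ v)

_∧_ : Word → Word → Word
(d1 ∷ u) ∧ (d1 ∷ v) = d1 ∷ (u ∧ v)
(d2 ∷ u) ∧ (d2 ∷ v) = d2 ∷ (u ∧ v)
_        ∧ _        = []

-- A full binary tree (finite prefix-closed subset of
-- {1,2}^* in which every vertex has 0 or 2 children) is represented by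
-- the usual inductive type; its vertex set is given by _∈T_.

data BTree : Set where
  leaf : BTree
  node : BTree → BTree → BTree

data _∈T_ : Word → BTree → Set where
  root  : ∀ {t} → [] ∈T t
  left  : ∀ {u l r} → u ∈T l → (d1 ∷ u) ∈T node l r
  right : ∀ {u l r} → u ∈T r → (d2 ∷ u) ∈T node l r

internal : BTree → ℕ
internal leaf       = 0
internal (node l r) = suc (internal l + internal r)

-- The trees τ_r.  τ₀ = {∅}, τ₁ = {∅,1,2},
-- τ_{2m} = {∅} ∪ 1τ_m ∪ 2τ_{m-1},  τ_{2m+1} = {∅} ∪ 1τ_m ∪ 2τ_m  (m ≥ 1).
-- Defined with a fuel argument (fuel r is enough since m < r).

isEven : ℕ → Bool
isEven zero          = true
isEven (suc zero)    = false
isEven (suc (suc n)) = isEven n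

τ-fuel : ℕ → ℕ → BTree
τ-fuel zero     _             = leaf
τ-fuel (suc f)  zero          = leaf
τ-fuel (suc f)  (suc zero)    = node leaf leaf
τ-fuel (suc f)  r@(suc (suc _)) =
  if isEven r
  then node (τ-fuel f ⌊ r /2⌋) (τ-fuel f (⌊ r /2⌋ ∸ 1))
  else node (τ-fuel f ⌊ r /2⌋) (τ-fuel f ⌊ r /2⌋)

τ : ℕ → BTree
τ r = τ-fuel r r

-- φ is an embedding of t into t' (only its values on vertices of t matter)
IsEmbedding : BTree → BTree → (Word → Word) → Set
IsEmbedding t t' φ =
  (∀ {u} → u ∈T t → φ u ∈T t') ×
  (∀ {u v} → u ∈T t → v ∈T t → φ u ≡ φ v → u ≡ v) ×
  (∀ {u v} → u ∈T t → v ∈T t → u <lex v → φ u <lex φ v) ×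
  (∀ {u v} → u ∈T t → v ∈T t → φ (u ∧ v) ≡ (φ u ∧ φ v))

Embeds : BTree → BTree → Set
Embeds t t' = ∃ λ φ → IsEmbedding t t' φ

HasStrahler : BTree → ℕ → Set
HasStrahler t h = Embeds (τ h) t × (∀ r → Embeds (τ r) t → r ≤ h)

record ℬ (n h : ℕ) : Set where
  constructor mkℬ
  field
    tree          : BTree
    .internal≡    : internal tree ≡ n
    .strahler≡    : HasStrahler tree h

-- Dyck paths: d : {0,…,2n} → ℕ, stored as a vector of length 2n+1

height : ∀ {k} → Vec ℕ k → ℕ
height v = foldr _⊔_ 0 (toList v)

IsDyck : (n : ℕ) → Vec ℕ (suc (2 * n)) → Set
IsDyck n d =
  lookup d fzero ≡ 0 ×
  last d ≡ 0 ×
  (∀ (i : Fin (2 * n)) →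
     lookup d (fsuc i) ≡ suc (lookup d (inject₁ i)) ⊎
     lookup d (inject₁ i) ≡ suc (lookup d (fsuc i)))

record 𝒟 (n h : ℕ) : Set where
  constructor mk𝒟
  field
    path     : Vec ℕ (suc (2 * n))
    .dyck    : IsDyck n path
    .height≡ : height path ≡ h

-- Embeddability of τ r into t has an inductive characterisation (_≼_), which turns
-- the refined Horton–Strahler number into the recursively computed `strahler`.  The
-- rotation correspondence (the Dyck path U A D B ↦ node A B) is a bijection from Dyck
-- paths of length 2n onto trees with n internal vertices, taking the height of the
-- path to `leftDepth` of the tree, so it suffices that strahler and leftDepth are
-- equidistributed.  Let a k n count the trees of size n with statistic ≤ k.  For both
-- statistics, with k = 1 + m + q and m ≤ q ≤ 1 + m,
--   a k (1 + n) = (a m ⋆ a k) n + (b ⋆ c) n,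
-- where b counts the trees with statistic in (m , k], c those with statistic < q, and
-- ⋆ is the Cauchy product: for strahler by a case analysis at the root, for leftDepth
-- through the identity leftDepth-between⋆atMost-shift.  Induction on n then gives
-- equal counts.

module Submission where

open import Defs

open import Data.Bool using (true; false; if_then_else_; T)
open import Data.Bool.Properties using (T-irrelevant; ∧-identityʳ; ∧-zeroʳ)
open import Data.Empty using (⊥; ⊥-elim)
open import Data.Fin using (Fin; inject₁) renaming (zero to fzero; suc to fsuc)
open import Data.Fin.Properties using (+↔⊎; 1↔⊤)
open import Data.List using (List; []; _∷_; _++_; length; drop; map; filter; cartesianProductWith)
open import Data.List.Properties using (∷-injectiveʳ; ++-cancelˡ; ++-identityʳ)
open import Data.Nat using (ℕ; zero; suc; _+_; _*_; _≤_; _<_; _⊔_; ⌊_/2⌋; z≤n; s≤s; _≤ᵇ_)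
open import Data.Nat.Induction using (<-rec)
open import Data.Nat.Properties
open import Data.Nat.Tactic.RingSolver using (solve-∀)
open import Data.Product using (Σ; ∃; _×_; _,_; proj₁; proj₂; swap)
open import Data.Sum using (_⊎_; inj₁; inj₂; [_,_]′)
open import Data.Sum.Function.Propositional using (_⊎-cong_)
open import Data.Unit using (⊤; tt)
open import Data.Vec as Vec using (Vec; []; _∷_; lookup)
open import Function using (_∘_)
open import Function.Bundles using (_⇔_; mk⇔; Equivalence; _↔_; mk↔ₛ′)
open import Function.Properties.Inverse using (↔-refl; ↔-sym; ↔-trans)
import Function.Related.Propositional as Related
open import Level using (0ℓ)
open import Relation.Binary using (DecidableEquality)
open import Relation.Binary.PropositionalEquality
open import Relation.Nullary using (¬_; ¬?; Dec; yes; no; does; _×-dec_; _⊎-dec_; map′; contradiction)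
open import Relation.Nullary.Decidable using (True; toWitness; fromWitness; dec-true; dec-false; recompute)
open import Relation.Unary using (Pred; Decidable)
open import Relation.Unary.Properties using (_∩?_; ∁?)

-- Words and embeddings

∧-++ : ∀ w x y → ((w ++ x) ∧ (w ++ y)) ≡ w ++ (x ∧ y)
∧-++ []       x y = refl
∧-++ (d1 ∷ w) x y = cong (d1 ∷_) (∧-++ w x y)
∧-++ (d2 ∷ w) x y = cong (d2 ∷_) (∧-++ w x y)

∧≡ˡ⇒prefix : ∀ x y → (x ∧ y) ≡ x → ∃ λ z → y ≡ x ++ z
∧≡ˡ⇒prefix []       y        _ = y , refl
∧≡ˡ⇒prefix (d1 ∷ x) (d1 ∷ y) e with ∧≡ˡ⇒prefix x y (∷-injectiveʳ e)
... | z , refl = z , refl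
∧≡ˡ⇒prefix (d2 ∷ x) (d2 ∷ y) e with ∧≡ˡ⇒prefix x y (∷-injectiveʳ e)
... | z , refl = z , refl
∧≡ˡ⇒prefix (d1 ∷ x) []       ()
∧≡ˡ⇒prefix (d1 ∷ x) (d2 ∷ y) ()
∧≡ˡ⇒prefix (d2 ∷ x) []       ()
∧≡ˡ⇒prefix (d2 ∷ x) (d1 ∷ y) ()

<lex-cancelˡ : ∀ w {x y} → (w ++ x) <lex (w ++ y) → x <lex y
<lex-cancelˡ []       p        = p
<lex-cancelˡ (_ ∷ w) (step p) = <lex-cancelˡ w p

branch-head₁ : ∀ {x y} → (x ∧ y) ≡ [] → x <lex y → x ≢ [] → ∃ λ z → x ≡ d1 ∷ z
branch-head₁ {[]}     _  _        x≢[] = ⊥-elim (x≢[] refl)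
branch-head₁ {d1 ∷ x} _  _        _    = x , refl
branch-head₁ {d2 ∷ x} () (step _) _

branch-head₂ : ∀ {x y} → (x ∧ y) ≡ [] → x <lex y → x ≢ [] → ∃ λ z → y ≡ d2 ∷ z
branch-head₂ {[]}               _  _        x≢[] = ⊥-elim (x≢[] refl)
branch-head₂ {_}      {d2 ∷ y} _  _        _    = y , refl
branch-head₂ {d1 ∷ x} {d1 ∷ y} () (step _) _

drop-length-++ : ∀ (w z : Word) → drop (length w) (w ++ z) ≡ z
drop-length-++ []      z = refl
drop-length-++ (_ ∷ w) z = drop-length-++ w z

subtree : BTree → Word → BTree
subtree t          []       = t
subtree leaf       (_ ∷ _)  = leaf
subtree (node l r) (d1 ∷ w) = subtree l w
subtree (node l r) (d2 ∷ w) = subtree r w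

∈T-subtree : ∀ t w {u} → (w ++ u) ∈T t → u ∈T subtree t w
∈T-subtree t          []       p         = p
∈T-subtree (node l r) (d1 ∷ w) (left p)  = ∈T-subtree l w p
∈T-subtree (node l r) (d2 ∷ w) (right p) = ∈T-subtree r w p

∈T-leaf : ∀ {u} → u ∈T leaf → u ≡ []
∈T-leaf root = refl

∧-∈T : ∀ {t u v} → u ∈T t → v ∈T t → (u ∧ v) ∈T t
∧-∈T root      _         = root
∧-∈T (left p)  root      = root
∧-∈T (left p)  (left q)  = left (∧-∈T p q)
∧-∈T (left p)  (right q) = root
∧-∈T (right p) root      = root
∧-∈T (right p) (left q)  = root
∧-∈T (right p) (right q) = right (∧-∈T p q)

infix 4 _≼_

data _≼_ : BTree → BTree → Set where
  leaf≼     : ∀ {t} → leaf ≼ t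
  ≼-left    : ∀ {s l r} → s ≼ l → s ≼ node l r
  ≼-right   : ∀ {s l r} → s ≼ r → s ≼ node l r
  node≼node : ∀ {a b l r} → a ≼ l → b ≼ r → node a b ≼ node l r

≼-refl : ∀ t → t ≼ t
≼-refl leaf       = leaf≼
≼-refl (node l r) = node≼node (≼-refl l) (≼-refl r)

≼-trans : ∀ {s t u} → s ≼ t → t ≼ u → s ≼ u
≼-trans p                (≼-left q)        = ≼-left (≼-trans p q)
≼-trans p                (≼-right q)       = ≼-right (≼-trans p q)
≼-trans leaf≼            leaf≼             = leaf≼
≼-trans leaf≼            (node≼node _ _)   = leaf≼
≼-trans (≼-left p)       (node≼node q _)   = ≼-left (≼-trans p q)
≼-trans (≼-right p)      (node≼node _ q)   = ≼-right (≼-trans p q)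
≼-trans (node≼node p p′) (node≼node q q′)  = node≼node (≼-trans p q) (≼-trans p′ q′)

subtree-≼ : ∀ t {w} → w ∈T t → subtree t w ≼ t
subtree-≼ t          root      = ≼-refl t
subtree-≼ (node l r) (left p)  = ≼-left (subtree-≼ l p)
subtree-≼ (node l r) (right p) = ≼-right (subtree-≼ r p)

leaf-embeds : ∀ t → Embeds leaf t
leaf-embeds t = (λ _ → []) , (λ _ → root) , inj , (λ { root root () }) , (λ _ _ → refl)
  where
  inj : ∀ {u v} → u ∈T leaf → v ∈T leaf → [] ≡ [] → u ≡ v
  inj root root _ = refl

embeds-left : ∀ {s l r} → Embeds s l → Embeds s (node l r)
embeds-left (φ , mem , inj , ord , meet) =
  (d1 ∷_) ∘ φ , left ∘ mem , (λ p q → inj p q ∘ ∷-injectiveʳ) ,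
  (λ p q → step ∘ ord p q) , (λ p q → cong (d1 ∷_) (meet p q))

embeds-right : ∀ {s l r} → Embeds s r → Embeds s (node l r)
embeds-right (φ , mem , inj , ord , meet) =
  (d2 ∷_) ∘ φ , right ∘ mem , (λ p q → inj p q ∘ ∷-injectiveʳ) ,
  (λ p q → step ∘ ord p q) , (λ p q → cong (d2 ∷_) (meet p q))

node-embeds : ∀ {a b l r} → Embeds a l → Embeds b r → Embeds (node a b) (node l r)
node-embeds {a} {b} {l} {r} (φˡ , memˡ , injˡ , ordˡ , meetˡ) (φʳ , memʳ , injʳ , ordʳ , meetʳ) =
  φ , mem , inj , ord , meet
  where
  φ : Word → Word
  φ []       = []
  φ (d1 ∷ u) = d1 ∷ φˡ u
  φ (d2 ∷ u) = d2 ∷ φʳ u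

  mem : ∀ {u} → u ∈T node a b → φ u ∈T node l r
  mem root      = root
  mem (left p)  = left (memˡ p)
  mem (right p) = right (memʳ p)

  inj : ∀ {u v} → u ∈T node a b → v ∈T node a b → φ u ≡ φ v → u ≡ v
  inj root      root      _ = refl
  inj (left p)  (left q)  e = cong (d1 ∷_) (injˡ p q (∷-injectiveʳ e))
  inj (right p) (right q) e = cong (d2 ∷_) (injʳ p q (∷-injectiveʳ e))
  inj root      (left _)  ()
  inj root      (right _) ()
  inj (left _)  root      ()
  inj (left _)  (right _) ()
  inj (right _) root      ()
  inj (right _) (left _)  ()

  ord : ∀ {u v} → u ∈T node a b → v ∈T node a b → u <lex v → φ u <lex φ v
  ord root      (left _)  _         = nil<cons
  ord root      (right _) _         = nil<cons
  ord (left p)  (left q)  (step lt) = step (ordˡ p q lt)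
  ord (left _)  (right _) _         = 1<2
  ord (right p) (right q) (step lt) = step (ordʳ p q lt)

  meet : ∀ {u v} → u ∈T node a b → v ∈T node a b → φ (u ∧ v) ≡ (φ u ∧ φ v)
  meet root      _         = refl
  meet (left p)  root      = refl
  meet (left p)  (left q)  = cong (d1 ∷_) (meetˡ p q)
  meet (left p)  (right q) = refl
  meet (right p) root      = refl
  meet (right p) (left q)  = refl
  meet (right p) (right q) = cong (d2 ∷_) (meetʳ p q)

≼⇒Embeds : ∀ {s t} → s ≼ t → Embeds s t
≼⇒Embeds {t = t} leaf≼ = leaf-embeds t
≼⇒Embeds (≼-left p)      = embeds-left (≼⇒Embeds p)
≼⇒Embeds (≼-right p)     = embeds-right (≼⇒Embeds p)
≼⇒Embeds (node≼node p q) = node-embeds (≼⇒Embeds p) (≼⇒Embeds q)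

restrict-left : ∀ {a b t φ} → IsEmbedding (node a b) t φ → IsEmbedding a t (φ ∘ (d1 ∷_))
restrict-left (mem , inj , ord , meet) =
  mem ∘ left , (λ p q → ∷-injectiveʳ ∘ inj (left p) (left q)) ,
  (λ p q → ord (left p) (left q) ∘ step) , (λ p q → meet (left p) (left q))

restrict-right : ∀ {a b t φ} → IsEmbedding (node a b) t φ → IsEmbedding b t (φ ∘ (d2 ∷_))
restrict-right (mem , inj , ord , meet) =
  mem ∘ right , (λ p q → ∷-injectiveʳ ∘ inj (right p) (right q)) ,
  (λ p q → ord (right p) (right q) ∘ step) , (λ p q → meet (right p) (right q))

embeds-below : ∀ {s t φ} (w : Word) → IsEmbedding s t φ →
               (∀ {u} → u ∈T s → ∃ λ z → φ u ≡ w ++ z) →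
               ∃ λ ψ → IsEmbedding s (subtree t w) ψ × (∀ {u} → u ∈T s → φ u ≡ w ++ ψ u)
embeds-below {s} {t} {φ} w (mem , inj , ord , meet) below =
  ψ , ((λ p → ∈T-subtree t w (subst (_∈T t) (φ≡w++ψ p) (mem p))) ,
  (λ p q e → inj p q (trans (φ≡w++ψ p) (trans (cong (w ++_) e) (sym (φ≡w++ψ q))))) ,
  (λ p q lt → <lex-cancelˡ w (subst₂ _<lex_ (φ≡w++ψ p) (φ≡w++ψ q) (ord p q lt))) ,
  ψ-meet) , φ≡w++ψ
  where
  ψ : Word → Word
  ψ u = drop (length w) (φ u)

  φ≡w++ψ : ∀ {u} → u ∈T s → φ u ≡ w ++ ψ u
  φ≡w++ψ p with below p
  ... | z , e rewrite e = cong (w ++_) (sym (drop-length-++ w z))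

  ψ-meet : ∀ {u v} → u ∈T s → v ∈T s → ψ (u ∧ v) ≡ (ψ u ∧ ψ v)
  ψ-meet {u} {v} p q = ++-cancelˡ w _ _ (begin
    w ++ ψ (u ∧ v)           ≡⟨ sym (φ≡w++ψ (∧-∈T p q)) ⟩
    φ (u ∧ v)                ≡⟨ meet p q ⟩
    (φ u ∧ φ v)              ≡⟨ cong₂ _∧_ (φ≡w++ψ p) (φ≡w++ψ q) ⟩
    ((w ++ ψ u) ∧ (w ++ ψ v)) ≡⟨ ∧-++ w (ψ u) (ψ v) ⟩
    w ++ (ψ u ∧ ψ v)         ∎)
    where open ≡-Reasoning

root-preserving⇒≼ : ∀ {a b t ψ} → IsEmbedding (node a b) t ψ → ψ [] ≡ [] → node a b ≼ t

Embeds⇒≼ : ∀ {s t} → Embeds s t → s ≼ t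
Embeds⇒≼ {leaf} _ = leaf≼
Embeds⇒≼ {node a b} {t} (φ , e@(mem , _ , _ , meet))
  with embeds-below (φ []) e (λ p → ∧≡ˡ⇒prefix (φ []) _ (sym (meet root p)))
... | ψ , e′ , φ≡w++ψ = ≼-trans (root-preserving⇒≼ e′ ψ[]≡[]) (subtree-≼ t (mem root))
  where
  ψ[]≡[] : ψ [] ≡ []
  ψ[]≡[] = ++-cancelˡ (φ []) _ _ (trans (sym (φ≡w++ψ root)) (sym (++-identityʳ (φ []))))

root-preserving⇒≼ {t = leaf} (mem , inj , _) ψ[]≡[]
  with inj (left root) root (trans (∈T-leaf (mem (left root))) (sym ψ[]≡[]))
... | ()
-- The meet of a left and a right vertex is the root, which ψ keeps at the root; as ψ
-- preserves the order, the two sides land below 1 and below 2.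
root-preserving⇒≼ {a} {b} {node L R} {ψ} e@(mem , inj , ord , meet) ψ[]≡[] =
  node≼node (Embeds⇒≼ (below (d1 ∷ []) (restrict-left e) lefts))
            (Embeds⇒≼ (below (d2 ∷ []) (restrict-right e) rights))
  where
  below : ∀ {s φ} (w : Word) → IsEmbedding s (node L R) φ →
          (∀ {u} → u ∈T s → ∃ λ z → φ u ≡ w ++ z) → Embeds s (subtree (node L R) w)
  below w e′ p with embeds-below w e′ p
  ... | ψ′ , e″ , _ = ψ′ , e″

  nonroot : ∀ {u} → u ∈T node a b → u ≢ [] → ψ u ≢ []
  nonroot p u≢[] ψu≡[] = u≢[] (inj p root (trans ψu≡[] (sym ψ[]≡[])))

  branches : ∀ {u v} (p : u ∈T a) (q : v ∈T b) → (ψ (d1 ∷ u) ∧ ψ (d2 ∷ v)) ≡ []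
  branches p q = trans (sym (meet (left p) (right q))) ψ[]≡[]

  lefts : ∀ {u} → u ∈T a → ∃ λ z → ψ (d1 ∷ u) ≡ d1 ∷ z
  lefts p = branch-head₁ (branches p root) (ord (left p) (right root) 1<2) (nonroot (left p) λ ())

  rights : ∀ {v} → v ∈T b → ∃ λ z → ψ (d2 ∷ v) ≡ d2 ∷ z
  rights q = branch-head₂ (branches root q) (ord (left root) (right q) 1<2) (nonroot (left root) λ ())

-- The refined Horton–Strahler number

τ-fuel-irrelevant : ∀ f g r → r ≤ f → r ≤ g → τ-fuel f r ≡ τ-fuel g r
τ-fuel-irrelevant zero    zero    zero          _       _       = refl
τ-fuel-irrelevant zero    (suc g) zero          _       _       = refl
τ-fuel-irrelevant (suc f) zero    zero          _       _       = refl
τ-fuel-irrelevant (suc f) (suc g) zero          _       _       = refl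
τ-fuel-irrelevant (suc f) (suc g) (suc zero)    _       _       = refl
τ-fuel-irrelevant (suc f) (suc g) (suc (suc k)) (s≤s p) (s≤s q) with isEven k
... | true  = cong₂ node (τ-fuel-irrelevant f g _ half≤f half≤g)
                         (τ-fuel-irrelevant f g _ (≤-trans (n≤1+n _) half≤f) (≤-trans (n≤1+n _) half≤g))
  where half≤f = ≤-trans (s≤s (⌊n/2⌋≤n k)) p
        half≤g = ≤-trans (s≤s (⌊n/2⌋≤n k)) q
... | false = cong₂ node (τ-fuel-irrelevant f g _ half≤f half≤g) (τ-fuel-irrelevant f g _ half≤f half≤g)
  where half≤f = ≤-trans (s≤s (⌊n/2⌋≤n k)) p
        half≤g = ≤-trans (s≤s (⌊n/2⌋≤n k)) q

τ-fuel-≥ : ∀ f r → r ≤ f → τ-fuel f r ≡ τ r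
τ-fuel-≥ f r r≤f = τ-fuel-irrelevant f r r r≤f ≤-refl

isEven-double : ∀ m → isEven (m + m) ≡ true
isEven-double zero    = refl
isEven-double (suc m) rewrite +-suc m m = isEven-double m

isEven-suc-double : ∀ m → isEven (suc (m + m)) ≡ false
isEven-suc-double zero    = refl
isEven-suc-double (suc m) rewrite +-suc m m = isEven-suc-double m

τ-suc-suc : ∀ k → τ (suc (suc k)) ≡ (if isEven k then node (τ (suc ⌊ k /2⌋)) (τ ⌊ k /2⌋)
                                            else node (τ (suc ⌊ k /2⌋)) (τ (suc ⌊ k /2⌋)))
τ-suc-suc k with isEven k
... | true  = cong₂ node (τ-fuel-≥ _ _ (s≤s (⌊n/2⌋≤n k))) (τ-fuel-≥ _ _ (m≤n⇒m≤1+n (⌊n/2⌋≤n k)))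
... | false = cong₂ node (τ-fuel-≥ _ _ (s≤s (⌊n/2⌋≤n k))) (τ-fuel-≥ _ _ (s≤s (⌊n/2⌋≤n k)))

τ-odd : ∀ m → τ (suc (m + m)) ≡ node (τ m) (τ m)
τ-odd zero = refl
τ-odd (suc m) rewrite +-suc m m | τ-suc-suc (suc (m + m)) | isEven-suc-double m | sym (n≡⌈n+n/2⌉ m) = refl

τ-even : ∀ m → τ (suc (suc (m + m))) ≡ node (τ (suc m)) (τ m)
τ-even m rewrite τ-suc-suc (m + m) | isEven-double m | sym (n≡⌊n+n/2⌋ m) = refl

τ-odd-suc : ∀ m → τ (suc (suc (suc (m + m)))) ≡ node (τ (suc m)) (τ (suc m))
τ-odd-suc m = trans (cong (τ ∘ suc ∘ suc) (sym (+-suc m m))) (τ-odd (suc m))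

data Parity : ℕ → Set where
  nil  : Parity 0
  odd  : ∀ m → Parity (suc (m + m))
  even : ∀ m → Parity (suc (suc (m + m)))

parity : ∀ r → Parity r
parity zero = nil
parity (suc r) with parity r
... | nil    = odd 0
... | odd m  = even m
... | even m = subst Parity (cong (suc ∘ suc) (+-suc m m)) (odd (suc m))

τ≼τ-suc : ∀ r → τ r ≼ τ (suc r)
τ≼τ-suc = <-rec (λ r → τ r ≼ τ (suc r)) by-parity
  where
  by-parity : ∀ r → (∀ {m} → m < r → τ m ≼ τ (suc m)) → τ r ≼ τ (suc r)
  by-parity r rec with parity r
  ... | nil    = leaf≼
  ... | odd m  rewrite τ-odd m | τ-even m =
    node≼node (rec (s≤s (m≤m+n m m))) (≼-refl (τ m))
  ... | even m rewrite τ-even m | τ-odd-suc m =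
    node≼node (≼-refl (τ (suc m))) (rec (s≤s (m≤n⇒m≤1+n (m≤m+n m m))))

τ-mono : ∀ {r r′} → r ≤ r′ → τ r ≼ τ r′
τ-mono {r′ = zero}   z≤n = ≼-refl leaf
τ-mono {r′ = suc r′} r≤ with m≤n⇒m<n∨m≡n r≤
... | inj₁ (s≤s r≤r′) = ≼-trans (τ-mono r≤r′) (τ≼τ-suc r′)
... | inj₂ refl       = ≼-refl (τ (suc r′))

-- the largest r with τ r ≼ node (τ a) (τ b) through node≼node
rootRank : ℕ → ℕ → ℕ
rootRank a b = if a ≤ᵇ b then suc (a + a) else suc (suc (b + b))

rootRank-cases : ∀ a b → (a ≤ b × rootRank a b ≡ suc (a + a)) ⊎ (b < a × rootRank a b ≡ suc (suc (b + b)))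
rootRank-cases a b with a ≤ᵇ b in e
... | true  = inj₁ (≤ᵇ⇒≤ a b (subst T (sym e) tt) , refl)
... | false = inj₂ (≰⇒> (λ a≤b → subst T e (≤⇒≤ᵇ a≤b)) , refl)

strahler : BTree → ℕ
strahler leaf       = 0
strahler (node l r) = (strahler l ⊔ strahler r) ⊔ rootRank (strahler l) (strahler r)

τ-rootRank≼ : ∀ a b → τ (rootRank a b) ≼ node (τ a) (τ b)
τ-rootRank≼ a b with rootRank-cases a b
... | inj₁ (a≤b , e) rewrite e | τ-odd a  = node≼node (≼-refl (τ a)) (τ-mono a≤b)
... | inj₂ (b<a , e) rewrite e | τ-even b = node≼node (τ-mono b<a) (≼-refl (τ b))

odd≤rootRank : ∀ {m a b} → m ≤ a → m ≤ b → suc (m + m) ≤ rootRank a b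
odd≤rootRank {m} {a} {b} m≤a m≤b with rootRank-cases a b
... | inj₁ (_ , e) rewrite e = s≤s (+-mono-≤ m≤a m≤a)
... | inj₂ (_ , e) rewrite e = s≤s (m≤n⇒m≤1+n (+-mono-≤ m≤b m≤b))

even≤rootRank : ∀ {m a b} → suc m ≤ a → m ≤ b → suc (suc (m + m)) ≤ rootRank a b
even≤rootRank {m} {a} {b} m<a m≤b with rootRank-cases a b
... | inj₁ (_ , e) rewrite e = s≤s (≤-trans (≤-reflexive (sym (+-suc m m))) (+-mono-≤ (<⇒≤ m<a) m<a))
... | inj₂ (_ , e) rewrite e = s≤s (s≤s (+-mono-≤ m≤b m≤b))

τ-⊔≼ : ∀ x y {t} → τ x ≼ t → τ y ≼ t → τ (x ⊔ y) ≼ t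
τ-⊔≼ x y p q with ⊔-sel x y
... | inj₁ e rewrite e = p
... | inj₂ e rewrite e = q

τ-strahler≼ : ∀ t → τ (strahler t) ≼ t
τ-strahler≼ leaf       = leaf≼
τ-strahler≼ (node l r) =
  τ-⊔≼ (strahler l ⊔ strahler r) (rootRank (strahler l) (strahler r))
    (τ-⊔≼ (strahler l) (strahler r) (≼-left (τ-strahler≼ l)) (≼-right (τ-strahler≼ r)))
    (≼-trans (τ-rootRank≼ (strahler l) (strahler r)) (node≼node (τ-strahler≼ l) (τ-strahler≼ r)))

module _ (l r : BTree) where
  private
    a = strahler l
    b = strahler r

  strahler-≥ˡ : a ≤ strahler (node l r)
  strahler-≥ˡ = ≤-trans (m≤m⊔n a b) (m≤m⊔n (a ⊔ b) (rootRank a b))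

  strahler-≥ʳ : b ≤ strahler (node l r)
  strahler-≥ʳ = ≤-trans (m≤n⊔m a b) (m≤m⊔n (a ⊔ b) (rootRank a b))

  strahler-≥rootRank : rootRank a b ≤ strahler (node l r)
  strahler-≥rootRank = m≤n⊔m (a ⊔ b) (rootRank a b)

τ≼⇒≤strahler : ∀ {r} t → τ r ≼ t → r ≤ strahler t
τ≼⇒≤strahler {r} t p with parity r
... | nil = z≤n
τ≼⇒≤strahler leaf p | odd m with subst (_≼ leaf) (τ-odd m) p
... | ()
τ≼⇒≤strahler leaf p | even m with subst (_≼ leaf) (τ-even m) p
... | ()
τ≼⇒≤strahler (node l r) p | odd m with subst (_≼ node l r) (τ-odd m) p
... | ≼-left q  = ≤-trans (τ≼⇒≤strahler l (subst (_≼ l) (sym (τ-odd m)) q)) (strahler-≥ˡ l r)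
... | ≼-right q = ≤-trans (τ≼⇒≤strahler r (subst (_≼ r) (sym (τ-odd m)) q)) (strahler-≥ʳ l r)
... | node≼node q q′ =
  ≤-trans (odd≤rootRank {m} (τ≼⇒≤strahler l q) (τ≼⇒≤strahler r q′)) (strahler-≥rootRank l r)
τ≼⇒≤strahler (node l r) p | even m with subst (_≼ node l r) (τ-even m) p
... | ≼-left q  = ≤-trans (τ≼⇒≤strahler l (subst (_≼ l) (sym (τ-even m)) q)) (strahler-≥ˡ l r)
... | ≼-right q = ≤-trans (τ≼⇒≤strahler r (subst (_≼ r) (sym (τ-even m)) q)) (strahler-≥ʳ l r)
... | node≼node q q′ =
  ≤-trans (even≤rootRank {m} (τ≼⇒≤strahler l q) (τ≼⇒≤strahler r q′)) (strahler-≥rootRank l r)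

hasStrahler⇔ : ∀ t h → HasStrahler t h ⇔ strahler t ≡ h
hasStrahler⇔ t h = mk⇔
  (λ (embeds , maximal) → ≤-antisym (maximal (strahler t) (≼⇒Embeds (τ-strahler≼ t)))
                                    (τ≼⇒≤strahler t (Embeds⇒≼ embeds)))
  (λ { refl → ≼⇒Embeds (τ-strahler≼ t) , λ r e → τ≼⇒≤strahler t (Embeds⇒≼ e) })

-- Counting trees

Seq : Set
Seq = ℕ → ℕ

infixl 7 _⋆_

_⋆_ : Seq → Seq → Seq
(f ⋆ g) zero    = f 0 * g 0
(f ⋆ g) (suc n) = f 0 * g (suc n) + (f ∘ suc ⋆ g) n

⋆-congᵇ : ∀ {f f′ g g′} n → (∀ {i} → i ≤ n → f i ≡ f′ i) → (∀ {i} → i ≤ n → g i ≡ g′ i) →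
          (f ⋆ g) n ≡ (f′ ⋆ g′) n
⋆-congᵇ zero    f≡ g≡ = cong₂ _*_ (f≡ z≤n) (g≡ z≤n)
⋆-congᵇ (suc n) f≡ g≡ =
  cong₂ _+_ (cong₂ _*_ (f≡ z≤n) (g≡ ≤-refl)) (⋆-congᵇ n (f≡ ∘ s≤s) (g≡ ∘ m≤n⇒m≤1+n))

⋆-cong : ∀ {f f′ g g′} → f ≗ f′ → g ≗ g′ → f ⋆ g ≗ f′ ⋆ g′
⋆-cong f≗ g≗ n = ⋆-congᵇ n (λ {i} _ → f≗ i) (λ {i} _ → g≗ i)

⋆-suc-last : ∀ f g n → (f ⋆ g) (suc n) ≡ (f ⋆ g ∘ suc) n + f (suc n) * g 0
⋆-suc-last f g zero    = refl
⋆-suc-last f g (suc n) =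
  trans (cong (f 0 * g (suc (suc n)) +_) (⋆-suc-last (f ∘ suc) g n))
        (sym (+-assoc (f 0 * g (suc (suc n))) _ _))

⋆-comm : ∀ f g → f ⋆ g ≗ g ⋆ f
⋆-comm f g zero    = *-comm (f 0) (g 0)
⋆-comm f g (suc n) = begin
  f 0 * g (suc n) + (f ∘ suc ⋆ g) n ≡⟨ cong (f 0 * g (suc n) +_) (⋆-comm (f ∘ suc) g n) ⟩
  f 0 * g (suc n) + (g ⋆ f ∘ suc) n ≡⟨ +-comm (f 0 * g (suc n)) _ ⟩
  (g ⋆ f ∘ suc) n + f 0 * g (suc n) ≡⟨ cong ((g ⋆ f ∘ suc) n +_) (*-comm (f 0) (g (suc n))) ⟩
  (g ⋆ f ∘ suc) n + g (suc n) * f 0 ≡⟨ sym (⋆-suc-last g f n) ⟩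
  (g ⋆ f) (suc n)                   ∎
  where open ≡-Reasoning

⋆-distribʳ-+ : ∀ f f′ g → (λ i → f i + f′ i) ⋆ g ≗ (λ n → (f ⋆ g) n + (f′ ⋆ g) n)
⋆-distribʳ-+ f f′ g zero    = *-distribʳ-+ (g 0) (f 0) (f′ 0)
⋆-distribʳ-+ f f′ g (suc n) =
  trans (cong ((f 0 + f′ 0) * g (suc n) +_) (⋆-distribʳ-+ (f ∘ suc) (f′ ∘ suc) g n))
        (rearrange (f 0) (f′ 0) (g (suc n)) _ _)
  where
  rearrange : ∀ a b c x y → (a + b) * c + (x + y) ≡ (a * c + x) + (b * c + y)
  rearrange = solve-∀

⋆-*ˡ : ∀ c f g → (λ i → c * f i) ⋆ g ≗ (λ n → c * (f ⋆ g) n)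
⋆-*ˡ c f g zero    = *-assoc c (f 0) (g 0)
⋆-*ˡ c f g (suc n) =
  trans (cong (c * f 0 * g (suc n) +_) (⋆-*ˡ c (f ∘ suc) g n))
        (rearrange c (f 0) (g (suc n)) _)
  where
  rearrange : ∀ a b d x → a * b * d + a * x ≡ a * (b * d + x)
  rearrange = solve-∀

⋆-assoc : ∀ f g h → (f ⋆ g) ⋆ h ≗ f ⋆ (g ⋆ h)
⋆-assoc f g h zero    = *-assoc (f 0) (g 0) (h 0)
⋆-assoc f g h (suc n) = begin
  f 0 * g 0 * h (suc n) + ((f ⋆ g) ∘ suc ⋆ h) n
    ≡⟨ cong (f 0 * g 0 * h (suc n) +_) (⋆-distribʳ-+ (λ i → f 0 * g (suc i)) (f ∘ suc ⋆ g) h n) ⟩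
  f 0 * g 0 * h (suc n) + (((λ i → f 0 * g (suc i)) ⋆ h) n + ((f ∘ suc ⋆ g) ⋆ h) n)
    ≡⟨ cong₂ (λ x y → f 0 * g 0 * h (suc n) + (x + y)) (⋆-*ˡ (f 0) (g ∘ suc) h n) (⋆-assoc (f ∘ suc) g h n) ⟩
  f 0 * g 0 * h (suc n) + (f 0 * (g ∘ suc ⋆ h) n + (f ∘ suc ⋆ (g ⋆ h)) n)
    ≡⟨ rearrange (f 0) (g 0) (h (suc n)) _ _ ⟩
  f 0 * (g 0 * h (suc n) + (g ∘ suc ⋆ h) n) + (f ∘ suc ⋆ (g ⋆ h)) n
    ∎
  where
  open ≡-Reasoning
  rearrange : ∀ a b c x y → a * b * c + (a * x + y) ≡ a * (b * c + x) + y
  rearrange = solve-∀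

⋆-zeroˡ : ∀ {f : Seq} (g : Seq) → (∀ i → f i ≡ 0) → ∀ n → (f ⋆ g) n ≡ 0
⋆-zeroˡ g f≡0 zero    rewrite f≡0 0 = refl
⋆-zeroˡ g f≡0 (suc n) rewrite f≡0 0 = ⋆-zeroˡ g (f≡0 ∘ suc) n

recurrence-unique : ∀ (W G : Seq) {E F : Seq} → E 0 ≡ F 0 →
                    (∀ n → E (suc n) ≡ G n + (W ⋆ E) n) → (∀ n → F (suc n) ≡ G n + (W ⋆ F) n) →
                    E ≗ F
recurrence-unique W G {E} {F} E₀≡F₀ recE recF n = agree-below n ≤-refl
  where
  agree-below : ∀ n {i} → i ≤ n → E i ≡ F i
  agree-below n       {zero}  _       = E₀≡F₀
  agree-below (suc n) {suc i} (s≤s i≤n) = begin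
    E (suc i)        ≡⟨ recE i ⟩
    G i + (W ⋆ E) i  ≡⟨ cong (G i +_) (⋆-congᵇ i (λ _ → refl) (λ j≤i → agree-below n (≤-trans j≤i i≤n))) ⟩
    G i + (W ⋆ F) i  ≡⟨ sym (recF i) ⟩
    F (suc i)        ∎
    where open ≡-Reasoning

count : ∀ {A : Set} {P : Pred A 0ℓ} → Decidable P → List A → ℕ
count P? []       = 0
count P? (x ∷ xs) = if does (P? x) then suc (count P? xs) else count P? xs

module _ {A : Set} {P Q : Pred A 0ℓ} (P? : Decidable P) (Q? : Decidable Q) where

  count-cong : (∀ x → P x ⇔ Q x) → ∀ xs → count P? xs ≡ count Q? xs
  count-cong P⇔Q []       = refl
  count-cong P⇔Q (x ∷ xs) with P? x | Q? x
  ... | yes _ | yes _ = cong suc (count-cong P⇔Q xs)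
  ... | no  _ | no  _ = count-cong P⇔Q xs
  ... | yes p | no ¬q = contradiction (Equivalence.to (P⇔Q x) p) ¬q
  ... | no ¬p | yes q = contradiction (Equivalence.from (P⇔Q x) q) ¬p

  count-split : ∀ xs → count P? xs ≡ count (P? ∩? Q?) xs + count (P? ∩? ∁? Q?) xs
  count-split []       = refl
  count-split (x ∷ xs) with P? x | Q? x
  ... | yes _ | yes _ = cong suc (count-split xs)
  ... | yes _ | no  _ = trans (cong suc (count-split xs)) (sym (+-suc _ _))
  ... | no  _ | _     = count-split xs

module _ {A : Set} {P : Pred A 0ℓ} (P? : Decidable P) where

  count-++ : ∀ xs ys → count P? (xs ++ ys) ≡ count P? xs + count P? ys
  count-++ []       ys = refl
  count-++ (x ∷ xs) ys with does (P? x)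
  ... | true  = cong suc (count-++ xs ys)
  ... | false = count-++ xs ys

  count-map : ∀ {B : Set} (g : B → A) xs → count P? (map g xs) ≡ count (P? ∘ g) xs
  count-map g []       = refl
  count-map g (x ∷ xs) with does (P? (g x))
  ... | true  = cong suc (count-map g xs)
  ... | false = count-map g xs

  count-none : (∀ x → ¬ P x) → ∀ xs → count P? xs ≡ 0
  count-none ¬P []       = refl
  count-none ¬P (x ∷ xs) with P? x
  ... | yes p = contradiction p (¬P x)
  ... | no  _ = count-none ¬P xs

module _ {A B C : Set} {P : Pred C 0ℓ} {Q : Pred A 0ℓ} {R : Pred B 0ℓ}
         (P? : Decidable P) (Q? : Decidable Q) (R? : Decidable R)
         (f : A → B → C) (P⇔ : ∀ x y → P (f x y) ⇔ (Q x × R y)) where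

  count-cartesianProductWith : ∀ xs ys →
    count P? (cartesianProductWith f xs ys) ≡ count Q? xs * count R? ys
  count-cartesianProductWith []       ys = refl
  count-cartesianProductWith (x ∷ xs) ys
    rewrite count-++ P? (map (f x) ys) (cartesianProductWith f xs ys)
          | count-cartesianProductWith xs ys
    with Q? x
  ... | yes q = cong (_+ count Q? xs * count R? ys) (trans (count-map P? (f x) ys)
                  (count-cong (P? ∘ f x) R? (λ y → mk⇔ (proj₂ ∘ Equivalence.to (P⇔ x y))
                                                      (λ r → Equivalence.from (P⇔ x y) (q , r))) ys))
  ... | no ¬q = cong (_+ count Q? xs * count R? ys) (trans (count-map P? (f x) ys)
                  (count-none (P? ∘ f x) (λ y p → ¬q (proj₁ (Equivalence.to (P⇔ x y) p))) ys))

pairs : (ℕ → List BTree) → (ℕ → List BTree) → ℕ → List BTree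
pairs F G zero    = cartesianProductWith node (F 0) (G 0)
pairs F G (suc n) = cartesianProductWith node (F 0) (G (suc n)) ++ pairs (F ∘ suc) G n

pairs-congᵇ : ∀ {F F′ G G′} n → (∀ {i} → i ≤ n → F i ≡ F′ i) → (∀ {i} → i ≤ n → G i ≡ G′ i) →
              pairs F G n ≡ pairs F′ G′ n
pairs-congᵇ zero    F≡ G≡ = cong₂ (cartesianProductWith node) (F≡ z≤n) (G≡ z≤n)
pairs-congᵇ (suc n) F≡ G≡ =
  cong₂ _++_ (cong₂ (cartesianProductWith node) (F≡ z≤n) (G≡ ≤-refl))
             (pairs-congᵇ n (F≡ ∘ s≤s) (G≡ ∘ m≤n⇒m≤1+n))

treesFuel : ℕ → ℕ → List BTree
treesFuel _       zero    = leaf ∷ []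
treesFuel zero    (suc n) = []
treesFuel (suc f) (suc n) = pairs (treesFuel f) (treesFuel f) n

trees : ℕ → List BTree
trees n = treesFuel n n

treesFuel-irrelevant : ∀ f g n → n ≤ f → n ≤ g → treesFuel f n ≡ treesFuel g n
treesFuel-irrelevant f       g       zero    _       _       = refl
treesFuel-irrelevant (suc f) (suc g) (suc n) (s≤s p) (s≤s q) =
  pairs-congᵇ n (λ i≤n → treesFuel-irrelevant f g _ (≤-trans i≤n p) (≤-trans i≤n q))
                (λ i≤n → treesFuel-irrelevant f g _ (≤-trans i≤n p) (≤-trans i≤n q))

treesFuel-≥ : ∀ f n → n ≤ f → treesFuel f n ≡ trees n
treesFuel-≥ f n n≤f = treesFuel-irrelevant f n n n≤f ≤-refl

#_ : {P : Pred BTree 0ℓ} → Decidable P → Seq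
(# P?) n = count P? (trees n)

module _ {P Q : Pred BTree 0ℓ} (P? : Decidable P) (Q? : Decidable Q) where

  #-cong : (∀ t → P t ⇔ Q t) → # P? ≗ # Q?
  #-cong P⇔Q n = count-cong P? Q? P⇔Q (trees n)

  #-split : ∀ n → (# P?) n ≡ (# (P? ∩? Q?)) n + (# (P? ∩? ∁? Q?)) n
  #-split n = count-split P? Q? (trees n)

#-none : {P : Pred BTree 0ℓ} (P? : Decidable P) → (∀ t → ¬ P t) → ∀ n → (# P?) n ≡ 0
#-none P? ¬P n = count-none P? ¬P (trees n)

#-node : ∀ {P A B : Pred BTree 0ℓ} (P? : Decidable P) (A? : Decidable A) (B? : Decidable B) →
         (∀ l r → P (node l r) ⇔ (A l × B r)) → ∀ n → (# P?) (suc n) ≡ (# A? ⋆ # B?) n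
#-node P? A? B? P⇔ n = trans (count-pairs (treesFuel n) (treesFuel n) n)
  (⋆-congᵇ n (λ {i} i≤n → cong (count A?) (treesFuel-≥ n i i≤n))
             (λ {i} i≤n → cong (count B?) (treesFuel-≥ n i i≤n)))
  where
  count-pairs : ∀ F G n → count P? (pairs F G n) ≡ (count A? ∘ F ⋆ count B? ∘ G) n
  count-pairs F G zero    = count-cartesianProductWith P? A? B? node P⇔ (F 0) (G 0)
  count-pairs F G (suc n) =
    trans (count-++ P? (cartesianProductWith node (F 0) (G (suc n))) (pairs (F ∘ suc) G n))
          (cong₂ _+_ (count-cartesianProductWith P? A? B? node P⇔ (F 0) (G (suc n)))
                     (count-pairs (F ∘ suc) G n))

#-suc-none : ∀ {P : Pred BTree 0ℓ} (P? : Decidable P) → (∀ l r → ¬ P (node l r)) → ∀ n → (# P?) (suc n) ≡ 0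
#-suc-none P? ¬P n =
  trans (#-node P? ⊥? P? (λ l r → mk⇔ (λ p → contradiction p (¬P l r)) (λ ())) n)
        (⋆-zeroˡ (# P?) (#-none ⊥? (λ _ ())) n)
  where
  ⊥? : Decidable {A = BTree} (λ _ → ⊥)
  ⊥? _ = no (λ ())

module _ (f : BTree → ℕ) where

  atMost : ℕ → Seq
  atMost k = # (λ t → f t ≤? k)

  between : ℕ → ℕ → Seq
  between L k = # (λ t → (L ≤? f t) ×-dec (f t ≤? k))

  below : ℕ → Seq
  below j = # (λ t → f t <? j)

  exactly : ℕ → Seq
  exactly h = # (λ t → f t ≟ h)

  between-zero : ∀ k → between 0 k ≗ atMost k
  between-zero k = #-cong _ _ (λ t → mk⇔ proj₂ (z≤n ,_))

  below-zero : ∀ n → below 0 n ≡ 0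
  below-zero = #-none _ (λ t ())

  below-suc : ∀ j → below (suc j) ≗ atMost j
  below-suc j = #-cong _ _ (λ t → mk⇔ ≤-pred s≤s)

  between-empty : ∀ p n → between (suc p) p n ≡ 0
  between-empty p = #-none _ (λ t (p<x , x≤p) → <⇒≱ p<x x≤p)

  atMost-split : ∀ {p k} → p ≤ k → ∀ n → atMost k n ≡ atMost p n + between (suc p) k n
  atMost-split {p} {k} p≤k n = trans (#-split _ (λ t → f t ≤? p) n)
    (cong₂ _+_ (#-cong _ _ (λ t → mk⇔ proj₂ (λ x≤p → ≤-trans x≤p p≤k , x≤p)) n)
               (#-cong _ _ (λ t → mk⇔ (λ (x≤k , x≰p) → ≰⇒> x≰p , x≤k)
                                      (λ (p<x , x≤k) → x≤k , <⇒≱ p<x)) n))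

  atMost-zero-suc : (∀ l r → 0 < f (node l r)) → ∀ n → atMost 0 (suc n) ≡ 0
  atMost-zero-suc 0<f = #-suc-none _ (λ l r f≤0 → <⇒≱ (0<f l r) f≤0)

exactly-cong : ∀ {f g} → (∀ k → atMost f k ≗ atMost g k) → ∀ h → exactly f h ≗ exactly g h
exactly-cong {f} {g} atMost≗ zero n = begin
  exactly f 0 n ≡⟨ #-cong _ _ (λ t → mk⇔ ≤-reflexive n≤0⇒n≡0) n ⟩
  atMost f 0 n  ≡⟨ atMost≗ 0 n ⟩
  atMost g 0 n  ≡⟨ #-cong _ _ (λ t → mk⇔ n≤0⇒n≡0 ≤-reflexive) n ⟩
  exactly g 0 n ∎
  where open ≡-Reasoning
exactly-cong {f} {g} atMost≗ (suc j) n = +-cancelˡ-≡ (atMost f j n) _ _ (begin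
  atMost f j n + exactly f (suc j) n         ≡⟨ cong (atMost f j n +_) (exactly≗between f) ⟩
  atMost f j n + between f (suc j) (suc j) n ≡⟨ sym (atMost-split f (n≤1+n j) n) ⟩
  atMost f (suc j) n                         ≡⟨ atMost≗ (suc j) n ⟩
  atMost g (suc j) n                         ≡⟨ atMost-split g (n≤1+n j) n ⟩
  atMost g j n + between g (suc j) (suc j) n ≡⟨ cong₂ _+_ (sym (atMost≗ j n)) (sym (exactly≗between g)) ⟩
  atMost f j n + exactly g (suc j) n         ∎)
  where
  open ≡-Reasoning
  exactly≗between : ∀ f → exactly f (suc j) n ≡ between f (suc j) (suc j) n
  exactly≗between f = #-cong _ _ (λ t → mk⇔ (λ e → ≤-reflexive (sym e) , ≤-reflexive e) (λ (p , q) → ≤-antisym q p)) n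

-- Equidistribution of strahler and leftDepth

onLeft : Pred BTree 0ℓ → Pred BTree 0ℓ
onLeft A leaf       = ⊥
onLeft A (node l _) = A l

onLeft? : ∀ {A} → Decidable A → Decidable (onLeft A)
onLeft? A? leaf       = no (λ ())
onLeft? A? (node l _) = A? l

-- the height of the Dyck path of t (height≡stackHeight)
leftDepth : BTree → ℕ
leftDepth leaf       = 0
leftDepth (node l r) = suc (leftDepth l) ⊔ leftDepth r

suc⊔≤suc⇔ : ∀ {a b K} → suc a ⊔ b ≤ suc K ⇔ (a ≤ K × b ≤ suc K)
suc⊔≤suc⇔ {a} {b} = mk⇔ (λ h≤ → ≤-pred (≤-trans (m≤m⊔n (suc a) b) h≤) , ≤-trans (m≤n⊔m (suc a) b) h≤)
                        (λ (a≤K , b≤) → ⊔-lub (s≤s a≤K) b≤)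

≤⊔⇒≤ʳ : ∀ {L x y} → L ≤ x ⊔ y → x < L → L ≤ y
≤⊔⇒≤ʳ {x = x} {y} L≤ x<L with ⊔-sel x y
... | inj₁ e = contradiction (≤-trans L≤ (≤-reflexive e)) (<⇒≱ x<L)
... | inj₂ e = ≤-trans L≤ (≤-reflexive e)

leftDepth-atMost-suc : ∀ K n →
  atMost leftDepth (suc K) (suc n) ≡ (atMost leftDepth K ⋆ atMost leftDepth (suc K)) n
leftDepth-atMost-suc K = #-node _ _ _ (λ l r → suc⊔≤suc⇔)

leftDepth-between-suc : ∀ L K n →
  between leftDepth (suc L) (suc K) (suc n) ≡
    (between leftDepth L K ⋆ atMost leftDepth (suc K)) n + (below leftDepth L ⋆ between leftDepth (suc L) (suc K)) n
leftDepth-between-suc L K n =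
  trans (#-split _ (onLeft? (λ t → L ≤? leftDepth t)) (suc n))
        (cong₂ _+_ (#-node _ _ _ (λ l r → mk⇔ to₁ from₁) n) (#-node _ _ _ (λ l r → mk⇔ to₂ from₂) n))
  where
  to₁ : ∀ {a b} → (suc L ≤ suc a ⊔ b × suc a ⊔ b ≤ suc K) × L ≤ a → (L ≤ a × a ≤ K) × b ≤ suc K
  to₁ ((_ , h≤) , L≤a) = let a≤K , b≤ = Equivalence.to suc⊔≤suc⇔ h≤ in (L≤a , a≤K) , b≤
  from₁ : ∀ {a b} → (L ≤ a × a ≤ K) × b ≤ suc K → (suc L ≤ suc a ⊔ b × suc a ⊔ b ≤ suc K) × L ≤ a
  from₁ {a} {b} ((L≤a , a≤K) , b≤) =
    (≤-trans (s≤s L≤a) (m≤m⊔n (suc a) b) , Equivalence.from suc⊔≤suc⇔ (a≤K , b≤)) , L≤a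
  to₂ : ∀ {a b} → (suc L ≤ suc a ⊔ b × suc a ⊔ b ≤ suc K) × ¬ L ≤ a → a < L × (suc L ≤ b × b ≤ suc K)
  to₂ ((L<h , h≤) , L≰a) = ≰⇒> L≰a , ≤⊔⇒≤ʳ L<h (s≤s (≰⇒> L≰a)) , proj₂ (Equivalence.to suc⊔≤suc⇔ h≤)
  from₂ : ∀ {a b} → a < L × (suc L ≤ b × b ≤ suc K) → (suc L ≤ suc a ⊔ b × suc a ⊔ b ≤ suc K) × ¬ L ≤ a
  from₂ {a} {b} (a<L , L<b , b≤) =
    (≤-trans L<b (m≤n⊔m (suc a) b) , ⊔-lub (≤-trans (s≤s (<⇒≤ a<L)) (≤-trans L<b b≤)) b≤) , <⇒≱ a<L

-- No tree of size 0 has leftDepth > L, so the product with g starts at Y ∘ suc.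
leftDepth-between⋆-suc : ∀ L K (g : Seq) n →
  (between leftDepth (suc L) (suc K) ⋆ g) (suc n) ≡
    ((between leftDepth L K ⋆ atMost leftDepth (suc K)) ⋆ g) n
      + (below leftDepth L ⋆ (between leftDepth (suc L) (suc K) ⋆ g)) n
leftDepth-between⋆-suc L K g n = begin
  (Y ∘ suc ⋆ g) n                                    ≡⟨ ⋆-cong (leftDepth-between-suc L K) (λ _ → refl) n ⟩
  ((λ i → G i + (W ⋆ Y) i) ⋆ g) n                    ≡⟨ ⋆-distribʳ-+ G (W ⋆ Y) g n ⟩
  (G ⋆ g) n + ((W ⋆ Y) ⋆ g) n                        ≡⟨ cong ((G ⋆ g) n +_) (⋆-assoc W Y g n) ⟩
  (G ⋆ g) n + (W ⋆ (Y ⋆ g)) n                        ∎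
  where
  open ≡-Reasoning
  Y = between leftDepth (suc L) (suc K)
  G = between leftDepth L K ⋆ atMost leftDepth (suc K)
  W = below leftDepth L

-- Both sides satisfy the same recurrence in n, by leftDepth-between⋆-suc.
leftDepth-between⋆atMost-shift : ∀ L m →
  between leftDepth L (L + m) ⋆ atMost leftDepth (suc (L + m)) ≗ between leftDepth L (suc (L + m)) ⋆ atMost leftDepth m
leftDepth-between⋆atMost-shift zero m n = begin
  (between leftDepth 0 m ⋆ atMost leftDepth (suc m)) n       ≡⟨ ⋆-cong (between-zero leftDepth m) (λ _ → refl) n ⟩
  (atMost leftDepth m ⋆ atMost leftDepth (suc m)) n          ≡⟨ ⋆-comm _ _ n ⟩
  (atMost leftDepth (suc m) ⋆ atMost leftDepth m) n          ≡⟨ ⋆-cong (between-zero leftDepth (suc m)) (λ _ → refl) n ⟨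
  (between leftDepth 0 (suc m) ⋆ atMost leftDepth m) n       ∎
  where open ≡-Reasoning
leftDepth-between⋆atMost-shift (suc L) m =
  recurrence-unique (below leftDepth L) G refl (leftDepth-between⋆-suc L K (atMost leftDepth (suc (suc K))))
    (λ n → trans (leftDepth-between⋆-suc L (suc K) (atMost leftDepth m) n)
                 (cong (_+ (below leftDepth L ⋆ (between leftDepth (suc L) (suc (suc K)) ⋆ atMost leftDepth m)) n) (sym (G≗G′ n))))
  where
  K = L + m
  G = (between leftDepth L K ⋆ atMost leftDepth (suc K)) ⋆ atMost leftDepth (suc (suc K))
  G≗G′ : G ≗ (between leftDepth L (suc K) ⋆ atMost leftDepth (suc (suc K))) ⋆ atMost leftDepth m
  G≗G′ n = begin
    ((Y ⋆ atMost leftDepth (suc K)) ⋆ D) n  ≡⟨ ⋆-cong (leftDepth-between⋆atMost-shift L m) (λ _ → refl) n ⟩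
    ((Y′ ⋆ atMost leftDepth m) ⋆ D) n       ≡⟨ ⋆-assoc Y′ _ D n ⟩
    (Y′ ⋆ (atMost leftDepth m ⋆ D)) n       ≡⟨ ⋆-cong (λ _ → refl) (⋆-comm (atMost leftDepth m) D) n ⟩
    (Y′ ⋆ (D ⋆ atMost leftDepth m)) n       ≡⟨ ⋆-assoc Y′ D _ n ⟨
    ((Y′ ⋆ D) ⋆ atMost leftDepth m) n       ∎
    where
    open ≡-Reasoning
    Y  = between leftDepth L K
    Y′ = between leftDepth L (suc K)
    D  = atMost leftDepth (suc (suc K))

leftDepth-atMost-recurrence : ∀ p q n →
  atMost leftDepth (suc (p + q)) (suc n) ≡
    (atMost leftDepth p ⋆ atMost leftDepth (suc (p + q))) n + (between leftDepth (suc p) (suc (p + q)) ⋆ below leftDepth q) n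
leftDepth-atMost-recurrence p q n = begin
  atMost leftDepth (suc (p + q)) (suc n)                                ≡⟨ leftDepth-atMost-suc (p + q) n ⟩
  (atMost leftDepth (p + q) ⋆ D) n                                      ≡⟨ ⋆-cong (atMost-split leftDepth (m≤m+n p q)) (λ _ → refl) n ⟩
  ((λ i → atMost leftDepth p i + between leftDepth (suc p) (p + q) i) ⋆ D) n
                                                                        ≡⟨ ⋆-distribʳ-+ _ _ D n ⟩
  (atMost leftDepth p ⋆ D) n + (between leftDepth (suc p) (p + q) ⋆ D) n ≡⟨ cong ((atMost leftDepth p ⋆ D) n +_) (shift q n) ⟩
  (atMost leftDepth p ⋆ D) n + (between leftDepth (suc p) (suc (p + q)) ⋆ below leftDepth q) n ∎
  where
  open ≡-Reasoning
  D = atMost leftDepth (suc (p + q))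
  shift : ∀ q → between leftDepth (suc p) (p + q) ⋆ atMost leftDepth (suc (p + q))
              ≗ between leftDepth (suc p) (suc (p + q)) ⋆ below leftDepth q
  shift zero n rewrite +-identityʳ p =
    trans (⋆-zeroˡ _ (between-empty leftDepth p) n)
          (sym (trans (⋆-comm _ _ n) (⋆-zeroˡ _ (below-zero leftDepth) n)))
  shift (suc q) n rewrite +-suc p q =
    trans (leftDepth-between⋆atMost-shift (suc p) q n) (⋆-cong (λ _ → refl) (λ i → sym (below-suc leftDepth q i)) n)

-- For k = 1 + m + q with m ≤ q ≤ 1 + m, a node has strahler ≤ k iff either its left
-- child has strahler ≤ m and its right child ≤ k, or its left child has strahler in
-- (m , k] and its right child < q.

module _ {m q} (m≤q : m ≤ q) (q≤1+m : q ≤ suc m) where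

  rootRank-≤ : ∀ {a b} → a ≤ m → rootRank a b ≤ suc (m + q)
  rootRank-≤ {a} {b} a≤m with rootRank-cases a b
  ... | inj₁ (_ , e)   rewrite e = s≤s (+-mono-≤ a≤m (≤-trans a≤m m≤q))
  ... | inj₂ (b<a , e) rewrite e = s≤s (+-mono-≤ (≤-trans b<a a≤m) (≤-trans (<⇒≤ b<a) (≤-trans a≤m m≤q)))

  rootRank-≤⇒< : ∀ {a b} → m < a → rootRank a b ≤ suc (m + q) → b < q
  rootRank-≤⇒< {a} {b} m<a r≤ with rootRank-cases a b
  ... | inj₁ (_ , e) = contradiction (begin-strict
        m + q           ≤⟨ +-monoʳ-≤ m q≤1+m ⟩
        m + suc m       <⟨ +-monoˡ-< (suc m) (n<1+n m) ⟩
        suc m + suc m   ≤⟨ +-mono-≤ m<a m<a ⟩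
        a + a           ≤⟨ ≤-pred (subst (_≤ suc (m + q)) e r≤) ⟩
        m + q           ∎) (n≮n (m + q))
    where open ≤-Reasoning
  ... | inj₂ (_ , e) = ≰⇒> λ q≤b → contradiction (begin-strict
        m + q           ≤⟨ +-monoˡ-≤ q m≤q ⟩
        q + q           ≤⟨ +-mono-≤ q≤b q≤b ⟩
        b + b           <⟨ n<1+n (b + b) ⟩
        suc (b + b)     ≤⟨ ≤-pred (subst (_≤ suc (m + q)) e r≤) ⟩
        m + q           ∎) (n≮n (m + q))
    where open ≤-Reasoning

  <⇒rootRank-≤ : ∀ {a b} → m < a → b < q → rootRank a b ≤ suc (m + q)
  <⇒rootRank-≤ {a} {b} m<a b<q with rootRank-cases a b
  ... | inj₁ (a≤b , _) = contradiction (≤-trans m<a (≤-trans a≤b b≤m)) (n≮n m)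
    where b≤m = ≤-pred (≤-trans b<q q≤1+m)
  ... | inj₂ (_ , e) rewrite e =
    s≤s (subst (_≤ m + q) (+-suc b b) (+-mono-≤ (≤-pred (≤-trans b<q q≤1+m)) b<q))

  strahler-atMost-recurrence : ∀ n →
    atMost strahler (suc (m + q)) (suc n) ≡
      (atMost strahler m ⋆ atMost strahler (suc (m + q))) n + (between strahler (suc m) (suc (m + q)) ⋆ below strahler q) n
  strahler-atMost-recurrence n =
    trans (#-split _ (onLeft? (λ t → strahler t ≤? m)) (suc n))
          (cong₂ _+_ (#-node _ _ _ (λ l r → mk⇔ to₁ from₁) n) (#-node _ _ _ (λ l r → mk⇔ to₂ from₂) n))
    where
    k = suc (m + q)
    ⊔⊔≤ : ∀ {a b c} → a ≤ k → b ≤ k → c ≤ k → (a ⊔ b) ⊔ c ≤ k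
    ⊔⊔≤ a≤ b≤ c≤ = ⊔-lub (⊔-lub a≤ b≤) c≤
    to₁ : ∀ {a b} → (a ⊔ b) ⊔ rootRank a b ≤ k × a ≤ m → a ≤ m × b ≤ k
    to₁ {a} {b} (s≤k , a≤m) = a≤m , m⊔n≤o⇒n≤o a b (m⊔n≤o⇒m≤o (a ⊔ b) _ s≤k)
    from₁ : ∀ {a b} → a ≤ m × b ≤ k → (a ⊔ b) ⊔ rootRank a b ≤ k × a ≤ m
    from₁ (a≤m , b≤k) = ⊔⊔≤ (≤-trans a≤m (m≤n⇒m≤1+n (m≤m+n m q))) b≤k (rootRank-≤ a≤m) , a≤m
    to₂ : ∀ {a b} → (a ⊔ b) ⊔ rootRank a b ≤ k × ¬ a ≤ m → (suc m ≤ a × a ≤ k) × b < q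
    to₂ {a} {b} (s≤k , a≰m) =
      (≰⇒> a≰m , m⊔n≤o⇒m≤o a b (m⊔n≤o⇒m≤o (a ⊔ b) _ s≤k)) ,
      rootRank-≤⇒< (≰⇒> a≰m) (m⊔n≤o⇒n≤o (a ⊔ b) _ s≤k)
    from₂ : ∀ {a b} → (suc m ≤ a × a ≤ k) × b < q → (a ⊔ b) ⊔ rootRank a b ≤ k × ¬ a ≤ m
    from₂ ((m<a , a≤k) , b<q) =
      ⊔⊔≤ a≤k (≤-trans (<⇒≤ b<q) (m≤n⇒m≤1+n (m≤n+m q m))) (<⇒rootRank-≤ m<a b<q) , <⇒≱ m<a

halve : ∀ K → ∃ λ m → ∃ λ q → m ≤ q × q ≤ suc m × K ≡ m + q
halve zero = 0 , 0 , z≤n , z≤n , refl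
halve (suc K) with halve K
... | m , q , m≤q , q≤1+m , refl with m≤n⇒m<n∨m≡n m≤q
...   | inj₁ m<q = suc m , q , m<q , m≤n⇒m≤1+n q≤1+m , refl
...   | inj₂ refl = m , suc m , n≤1+n m , ≤-refl , sym (+-suc m m)

AgreeUpTo : ℕ → Set
AgreeUpTo n = ∀ k {i} → i ≤ n → atMost strahler k i ≡ atMost leftDepth k i

agree-suc : ∀ n → AgreeUpTo n → ∀ k → atMost strahler k (suc n) ≡ atMost leftDepth k (suc n)
agree-suc n agree zero =
  trans (atMost-zero-suc strahler (λ l r → ≤-trans (rootRank-pos l r) (strahler-≥rootRank l r)) n)
        (sym (atMost-zero-suc leftDepth (λ l r → ≤-trans (s≤s z≤n) (m≤m⊔n _ (leftDepth r))) n))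
  where
  rootRank-pos : ∀ l r → 0 < rootRank (strahler l) (strahler r)
  rootRank-pos l r with rootRank-cases (strahler l) (strahler r)
  ... | inj₁ (_ , e) rewrite e = s≤s z≤n
  ... | inj₂ (_ , e) rewrite e = s≤s z≤n
agree-suc n agree (suc K) with halve K
... | m , q , m≤q , q≤1+m , refl = begin
  atMost strahler k (suc n)
    ≡⟨ strahler-atMost-recurrence m≤q q≤1+m n ⟩
  (atMost strahler m ⋆ atMost strahler k) n + (between strahler (suc m) k ⋆ below strahler q) n
    ≡⟨ cong₂ _+_ (⋆-congᵇ n (agree m) (agree k)) (⋆-congᵇ n between-agrees (below-agrees q)) ⟩
  (atMost leftDepth m ⋆ atMost leftDepth k) n + (between leftDepth (suc m) k ⋆ below leftDepth q) n
    ≡⟨ leftDepth-atMost-recurrence m q n ⟨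
  atMost leftDepth k (suc n)
    ∎
  where
  open ≡-Reasoning
  k = suc (m + q)
  m≤k = m≤n⇒m≤1+n (m≤m+n m q)
  between-agrees : ∀ {i} → i ≤ n → between strahler (suc m) k i ≡ between leftDepth (suc m) k i
  between-agrees {i} i≤n = +-cancelˡ-≡ (atMost strahler m i) _ _ (begin
    atMost strahler m i + between strahler (suc m) k i   ≡⟨ atMost-split strahler m≤k i ⟨
    atMost strahler k i                                  ≡⟨ agree k i≤n ⟩
    atMost leftDepth k i                                 ≡⟨ atMost-split leftDepth m≤k i ⟩
    atMost leftDepth m i + between leftDepth (suc m) k i ≡⟨ cong (_+ between leftDepth (suc m) k i) (agree m i≤n) ⟨
    atMost strahler m i + between leftDepth (suc m) k i  ∎)
  below-agrees : ∀ q {i} → i ≤ n → below strahler q i ≡ below leftDepth q i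
  below-agrees zero    {i} _   = trans (below-zero strahler i) (sym (below-zero leftDepth i))
  below-agrees (suc j) {i} i≤n = trans (below-suc strahler j i) (trans (agree j i≤n) (sym (below-suc leftDepth j i)))

agreeUpTo : ∀ n → AgreeUpTo n
agreeUpTo zero    k z≤n = refl
agreeUpTo (suc n) k i≤ with m≤n⇒m<n∨m≡n i≤
... | inj₁ (s≤s i≤n) = agreeUpTo n k i≤n
... | inj₂ refl      = agree-suc n (agreeUpTo n) k

exactly-strahler≗leftDepth : ∀ h → exactly strahler h ≗ exactly leftDepth h
exactly-strahler≗leftDepth = exactly-cong (λ k n → agreeUpTo n k ≤-refl)

-- From counts to bijections

indicator : ∀ {P : Set} → Dec P → ℕ
indicator P? = if does P? then 1 else 0

δ : ℕ → Seq
δ a i = indicator (a ≟ i)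

δ-⋆ : ∀ a b → δ a ⋆ δ b ≗ δ (a + b)
δ-⋆ zero    b zero    = *-identityˡ (δ b 0)
δ-⋆ (suc a) b zero    = refl
δ-⋆ zero    b (suc n) = trans (cong (1 * δ b (suc n) +_) (⋆-zeroˡ (δ b) (λ _ → refl) n))
                              (trans (+-identityʳ _) (*-identityˡ _))
δ-⋆ (suc a) b (suc n) = δ-⋆ a b n

node-injective : ∀ {a b x y} → node a b ≡ node x y → a ≡ x × b ≡ y
node-injective refl = refl , refl

_≟ᵀ_ : DecidableEquality BTree
leaf     ≟ᵀ leaf     = yes refl
leaf     ≟ᵀ node _ _ = no (λ ())
node _ _ ≟ᵀ leaf     = no (λ ())
node a b ≟ᵀ node x y = map′ (λ (a≡x , b≡y) → cong₂ node a≡x b≡y) node-injective ((a ≟ᵀ x) ×-dec (b ≟ᵀ y))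

trees-multiplicity : ∀ t → # (_≟ᵀ t) ≗ δ (internal t)
trees-multiplicity leaf       zero    = refl
trees-multiplicity (node x y) zero    = refl
trees-multiplicity leaf       (suc n) = #-suc-none _ (λ l r ()) n
trees-multiplicity (node x y) (suc n) = begin
  (# (_≟ᵀ node x y)) (suc n)         ≡⟨ #-node _ (_≟ᵀ x) (_≟ᵀ y) (λ l r → mk⇔ node-injective (λ { (refl , refl) → refl })) n ⟩
  (# (_≟ᵀ x) ⋆ # (_≟ᵀ y)) n         ≡⟨ ⋆-cong (trees-multiplicity x) (trees-multiplicity y) n ⟩
  (δ (internal x) ⋆ δ (internal y)) n ≡⟨ δ-⋆ (internal x) (internal y) n ⟩
  δ (internal x + internal y) n      ∎
  where open ≡-Reasoning

module _ {A : Set} {P : Pred A 0ℓ} (P? : Decidable P) where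

  length-filter≡count : ∀ xs → length (filter P? xs) ≡ count P? xs
  length-filter≡count []       = refl
  length-filter≡count (x ∷ xs) with does (P? x)
  ... | true  = cong suc (length-filter≡count xs)
  ... | false = length-filter≡count xs

  count-filter : ∀ {R : Pred A 0ℓ} (R? : Decidable R) xs → count R? (filter P? xs) ≡ count (P? ∩? R?) xs
  count-filter R? []       = refl
  count-filter R? (x ∷ xs) with does (P? x)
  ... | true  = cong (λ c → if does (R? x) then suc c else c) (count-filter R? xs)
  ... | false = count-filter R? xs

module _ {A : Set} (_≟ᴬ_ : DecidableEquality A) where

  Σ-remove : ∀ {Q : Pred A 0ℓ} (Q? : Decidable Q) {y} → Q y →
             Σ A (True ∘ Q?) ↔ (⊤ ⊎ Σ A (λ a → True (Q? a ×-dec ¬? (a ≟ᴬ y))))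
  Σ-remove Q? {y} Qy = mk↔ₛ′ to from to∘from from∘to
    where
    split : ∀ {a} → True (Q? a) → Dec (a ≡ y) → ⊤ ⊎ Σ A (λ a → True (Q? a ×-dec ¬? (a ≟ᴬ y)))
    split q (yes _)       = inj₁ tt
    split q (no a≢y)      = inj₂ (_ , fromWitness (toWitness q , a≢y))

    to : Σ A (True ∘ Q?) → ⊤ ⊎ Σ A (λ a → True (Q? a ×-dec ¬? (a ≟ᴬ y)))
    to (a , q) = split q (a ≟ᴬ y)

    from : ⊤ ⊎ Σ A (λ a → True (Q? a ×-dec ¬? (a ≟ᴬ y))) → Σ A (True ∘ Q?)
    from (inj₁ _)       = y , fromWitness Qy
    from (inj₂ (a , q)) = a , fromWitness (proj₁ (toWitness q))

    to∘from : ∀ x → to (from x) ≡ x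
    to∘from (inj₁ _) with y ≟ᴬ y
    ... | yes _   = refl
    ... | no  y≢y = contradiction refl y≢y
    to∘from (inj₂ (a , q)) = split-no (a ≟ᴬ y)
      where
      split-no : (a≟y : Dec (a ≡ y)) → split (fromWitness (proj₁ (toWitness q))) a≟y ≡ inj₂ (a , q)
      split-no (yes a≡y) = contradiction a≡y (proj₂ (toWitness q))
      split-no (no _)    = cong (λ q → inj₂ (a , q)) (T-irrelevant _ _)

    from∘to : ∀ x → from (to x) ≡ x
    from∘to (a , q) with a ≟ᴬ y
    ... | yes refl = cong (y ,_) (T-irrelevant _ _)
    ... | no  _    = cong (a ,_) (T-irrelevant _ _)

  enumeration↔Fin : ∀ {Q : Pred A 0ℓ} (Q? : Decidable Q) xs →
                    (∀ a → count (_≟ᴬ a) xs ≡ indicator (Q? a)) → Σ A (True ∘ Q?) ↔ Fin (length xs)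
  enumeration↔Fin Q? [] occurs =
    mk↔ₛ′ (λ (a , q) → contradiction q (absent a)) (λ ()) (λ ()) (λ (a , q) → contradiction q (absent a))
    where
    absent : ∀ a → ¬ True (Q? a)
    absent a q with Q? a | occurs a
    ... | yes _ | ()
  enumeration↔Fin {Q} Q? (y ∷ ys) occurs =
    ↔-trans (Σ-remove Q? (proj₁ first))
    (↔-trans (↔-refl ⊎-cong enumeration↔Fin (λ a → Q? a ×-dec ¬? (a ≟ᴬ y)) ys occurs′)
             (↔-sym (↔-trans (+↔⊎ {1}) (1↔⊤ ⊎-cong ↔-refl))))
    where
    first : Q y × count (_≟ᴬ y) ys ≡ 0
    first with occurs y
    ... | occ rewrite dec-true (y ≟ᴬ y) refl with Q? y | occ
    ...   | yes Qy | occ′ = Qy , suc-injective occ′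
    occurs′ : ∀ a → count (_≟ᴬ a) ys ≡ indicator (Q? a ×-dec ¬? (a ≟ᴬ y))
    occurs′ a with a ≟ᴬ y | occurs a
    ... | yes refl | _   rewrite ∧-zeroʳ (does (Q? a)) = proj₂ first
    ... | no  a≢y  | occ rewrite dec-false (y ≟ᴬ a) (a≢y ∘ sym) | ∧-identityʳ (does (Q? a)) = occ

#↔Fin : ∀ {P : Pred BTree 0ℓ} (P? : Decidable P) n →
        Σ BTree (λ t → True ((internal t ≟ n) ×-dec P? t)) ↔ Fin ((# P?) n)
#↔Fin {P} P? n = subst (λ k → Σ BTree (λ t → True ((internal t ≟ n) ×-dec P? t)) ↔ Fin k) (length-filter≡count P? (trees n))
  (enumeration↔Fin _≟ᵀ_ (λ t → (internal t ≟ n) ×-dec P? t) (filter P? (trees n)) occurs)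
  where
  occurs : ∀ t → count (_≟ᵀ t) (filter P? (trees n)) ≡ indicator ((internal t ≟ n) ×-dec P? t)
  occurs t rewrite count-filter P? (_≟ᵀ t) (trees n) with P? t
  ... | yes p rewrite ∧-identityʳ (does (internal t ≟ n)) =
    trans (count-cong (P? ∩? (_≟ᵀ t)) (_≟ᵀ t) (λ s → mk⇔ proj₂ (λ { refl → p , refl })) (trees n))
          (trees-multiplicity t n)
  ... | no ¬p rewrite ∧-zeroʳ (does (internal t ≟ n)) =
    count-none (P? ∩? (_≟ᵀ t)) (λ { s (p , refl) → ¬p p }) (trees n)

-- Dyck paths and the rotation correspondence

data Walk : ℕ → {m : ℕ} → Vec ℕ (suc m) → Set where
  end  : Walk 0 (0 ∷ [])
  up   : ∀ {c m} {v : Vec ℕ (suc m)} → Walk (suc c) v → Walk c (c ∷ v)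
  down : ∀ {c m} {v : Vec ℕ (suc m)} → Walk c v → Walk (suc c) (suc c ∷ v)

walk-head : ∀ {c m} {v : Vec ℕ (suc m)} → Walk c v → Vec.head v ≡ c
walk-head end      = refl
walk-head (up w)   = refl
walk-head (down w) = refl

walk-start-unique : ∀ {a b m} {v : Vec ℕ (suc m)} → Walk a v → Walk b v → a ≡ b
walk-start-unique w w′ = trans (sym (walk-head w)) (walk-head w′)

2+n≢n : ∀ {n} → suc (suc n) ≢ n
2+n≢n ()

walk-irrelevant : ∀ {c m} {v : Vec ℕ (suc m)} (w w′ : Walk c v) → w ≡ w′
walk-irrelevant end      end       = refl
walk-irrelevant (up w)   (up w′)   = cong up (walk-irrelevant w w′)
walk-irrelevant (down w) (down w′) = cong down (walk-irrelevant w w′)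
walk-irrelevant (up w)   (down w′) = contradiction (walk-start-unique w w′) 2+n≢n
walk-irrelevant (down w) (up w′)   = contradiction (walk-start-unique w′ w) 2+n≢n

walk? : ∀ c {m} (v : Vec ℕ (suc m)) → Dec (Walk c v)
walk? zero    (zero ∷ [])  = yes end
walk? zero    (suc _ ∷ []) = no (λ ())
walk? (suc c) (_ ∷ [])     = no (λ ())
walk? zero    (x ∷ y ∷ v) with x ≟ 0
... | no x≢0   = no (x≢0 ∘ walk-head)
... | yes refl = map′ up (λ { (up w) → w }) (walk? 1 (y ∷ v))
walk? (suc c) (x ∷ y ∷ v) with x ≟ suc c
... | no x≢c   = no (x≢c ∘ walk-head)
... | yes refl = map′ [ up , down ]′ (λ { (up w) → inj₁ w ; (down w) → inj₂ w })
                      (walk? (suc (suc c)) (y ∷ v) ⊎-dec walk? c (y ∷ v))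

Steps : ∀ {m} → Vec ℕ (suc m) → Set
Steps {m} v = ∀ (i : Fin m) → lookup v (fsuc i) ≡ suc (lookup v (inject₁ i)) ⊎ lookup v (inject₁ i) ≡ suc (lookup v (fsuc i))

steps⇒walk : ∀ {m} (v : Vec ℕ (suc m)) → Steps v → Vec.last v ≡ 0 → Walk (Vec.head v) v
steps⇒walk (x ∷ [])    _     refl = end
steps⇒walk (x ∷ y ∷ v) steps last≡0 with steps fzero
... | inj₁ refl = up   (steps⇒walk (y ∷ v) (steps ∘ fsuc) last≡0)
... | inj₂ refl = down (steps⇒walk (y ∷ v) (steps ∘ fsuc) last≡0)

steps-∷ : ∀ {c x y m} {v : Vec ℕ m} →
                  y ≡ suc x ⊎ x ≡ suc y → Walk c (y ∷ v) → Steps (x ∷ y ∷ v) × Vec.last (x ∷ y ∷ v) ≡ 0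

walk⇒steps : ∀ {c m} {v : Vec ℕ (suc m)} → Walk c v → Steps v × Vec.last v ≡ 0
walk⇒steps end                  = (λ ()) , refl
walk⇒steps (up {v = _ ∷ _} w)   = steps-∷ (inj₁ (walk-head w)) w
walk⇒steps (down {v = _ ∷ _} w) = steps-∷ (inj₂ (cong suc (sym (walk-head w)))) w

steps-∷ first w = (λ { fzero → first ; (fsuc i) → proj₁ (walk⇒steps w) i }) , proj₂ (walk⇒steps w)

isDyck⇔walk : ∀ n (v : Vec ℕ (suc (2 * n))) → IsDyck n v ⇔ Walk 0 v
isDyck⇔walk n (x ∷ v) = mk⇔ (λ { (refl , last≡0 , steps) → steps⇒walk (0 ∷ v) steps last≡0 })
                            (λ w → walk-head w , swap (walk⇒steps w))

-- A walk from height c encodes a stack of c + 1 trees: prefixing an up step merges the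
-- two top trees, prefixing a down step pushes a leaf.

Walks : ℕ → Set
Walks c = Σ ℕ λ m → Σ (Vec ℕ (suc m)) (Walk c)

end′ : Walks 0
end′ = 0 , (0 ∷ []) , end

up′ : ∀ {c} → Walks (suc c) → Walks c
up′ {c} (m , v , w) = suc m , (c ∷ v) , up w

down′ : ∀ {c} → Walks c → Walks (suc c)
down′ {c} (m , v , w) = suc m , (suc c ∷ v) , down w

merge : ∀ {c} → Vec BTree (suc (suc c)) → Vec BTree (suc c)
merge (a ∷ b ∷ ts) = node a b ∷ ts

stack : ∀ {c m} {v : Vec ℕ (suc m)} → Walk c v → Vec BTree (suc c)
stack end      = leaf ∷ []
stack (up w)   = merge (stack w)
stack (down w) = leaf ∷ stack w

stackOf : ∀ {c} → Walks c → Vec BTree (suc c)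
stackOf (_ , _ , w) = stack w

prependTree : ∀ {c} → BTree → Walks c → Walks c
prependTree leaf       W = W
prependTree (node x y) W = up′ (prependTree x (down′ (prependTree y W)))

unstack : ∀ {c} → Vec BTree (suc c) → Walks c
unstack {zero}  (t ∷ [])  = prependTree t end′
unstack {suc c} (t ∷ ts)  = prependTree t (down′ (unstack ts))

graft : BTree → BTree → BTree
graft leaf       s = s
graft (node x y) s = node x (graft y s)

graft-leaf : ∀ t → graft t leaf ≡ t
graft-leaf leaf       = refl
graft-leaf (node x y) = cong (node x) (graft-leaf y)

graftTop : ∀ {c} → BTree → Vec BTree (suc c) → Vec BTree (suc c)
graftTop t (s ∷ ss) = graft t s ∷ ss

stack-prependTree : ∀ {c} t (W : Walks c) → stackOf (prependTree t W) ≡ graftTop t (stackOf W)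
stack-prependTree leaf       W = graftTop-leaf (stackOf W)
  where graftTop-leaf : ∀ {c} (ts : Vec BTree (suc c)) → ts ≡ graftTop leaf ts
        graftTop-leaf (_ ∷ _) = refl
stack-prependTree (node x y) W = begin
  merge (stackOf (prependTree x (down′ (prependTree y W)))) ≡⟨ cong merge (stack-prependTree x (down′ (prependTree y W))) ⟩
  merge (graftTop x (leaf ∷ stackOf (prependTree y W)))      ≡⟨ cong (λ ts → merge (graftTop x (leaf ∷ ts))) (stack-prependTree y W) ⟩
  merge (graftTop x (leaf ∷ graftTop y (stackOf W)))         ≡⟨ merge-graftTop (stackOf W) ⟩
  graftTop (node x y) (stackOf W)                            ∎
  where
  open ≡-Reasoning
  merge-graftTop : ∀ {c} (ts : Vec BTree (suc c)) → merge (graftTop x (leaf ∷ graftTop y ts)) ≡ graftTop (node x y) ts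
  merge-graftTop (s ∷ ss) = cong (λ x′ → node x′ (graft y s) ∷ ss) (graft-leaf x)

stack-unstack : ∀ {c} (ts : Vec BTree (suc c)) → stackOf (unstack ts) ≡ ts
stack-unstack {zero}  (t ∷ [])  = trans (stack-prependTree t end′) (cong (_∷ []) (graft-leaf t))
stack-unstack {suc c} (t ∷ ts)  = trans (stack-prependTree t (down′ (unstack ts))) (cong₂ _∷_ (graft-leaf t) (stack-unstack ts))

unstack-merge : ∀ {c} (ts : Vec BTree (suc (suc c))) → unstack (merge ts) ≡ up′ (unstack ts)
unstack-merge {zero}  (a ∷ b ∷ [])  = refl
unstack-merge {suc c} (a ∷ b ∷ ts)  = refl

unstack-stack : ∀ {c m} {v : Vec ℕ (suc m)} (w : Walk c v) → unstack (stack w) ≡ (m , v , w)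
unstack-stack end      = refl
unstack-stack (up w)   = trans (unstack-merge (stack w)) (cong up′ (unstack-stack w))
unstack-stack (down w) = cong down′ (unstack-stack w)

size : ∀ {k} → Vec BTree k → ℕ
size []       = 0
size (t ∷ ts) = internal t + size ts

walk-length : ∀ {c m} {v : Vec ℕ (suc m)} (w : Walk c v) → m ≡ c + 2 * size (stack w)
walk-length end          = refl
walk-length (down w)     = cong suc (walk-length w)
walk-length {c} (up w) with stack w | walk-length w
... | a ∷ b ∷ ts | m≡ = trans (cong suc m≡) (rearrange c (internal a) (internal b) (size ts))
  where
  rearrange : ∀ c a b s → suc (suc c + 2 * (a + (b + s))) ≡ c + 2 * (suc (a + b) + s)
  rearrange = solve-∀

stackHeight : ∀ c → Vec BTree (suc c) → ℕ
stackHeight zero    (t ∷ [])  = leftDepth t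
stackHeight (suc c) (t ∷ ts)  = (suc c + leftDepth t) ⊔ stackHeight c ts

stackHeight-merge : ∀ c (ts : Vec BTree (suc (suc c))) → stackHeight c (merge ts) ≡ c ⊔ stackHeight (suc c) ts
stackHeight-merge zero    (a ∷ b ∷ [])  = refl
stackHeight-merge (suc c) (a ∷ b ∷ ts) = begin
  (C + (suc A ⊔ B)) ⊔ R                    ≡⟨ cong (_⊔ R) (+-distribˡ-⊔ C (suc A) B) ⟩
  ((C + suc A) ⊔ (C + B)) ⊔ R              ≡⟨ cong (λ x → (x ⊔ (C + B)) ⊔ R) (+-suc C A) ⟩
  ((suc C + A) ⊔ (C + B)) ⊔ R              ≡⟨ ⊔-assoc (suc C + A) (C + B) R ⟩
  (suc C + A) ⊔ ((C + B) ⊔ R)              ≡⟨ m≤n⇒m⊔n≡n C≤ ⟨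
  C ⊔ ((suc C + A) ⊔ ((C + B) ⊔ R))        ∎
  where
  open ≡-Reasoning
  C = suc c
  A = leftDepth a
  B = leftDepth b
  R = stackHeight c ts
  C≤ : C ≤ (suc C + A) ⊔ ((C + B) ⊔ R)
  C≤ = ≤-trans (m≤m+n C B) (≤-trans (m≤m⊔n (C + B) R) (m≤n⊔m (suc C + A) ((C + B) ⊔ R)))

height≡stackHeight : ∀ {c m} {v : Vec ℕ (suc m)} (w : Walk c v) → height v ≡ stackHeight c (stack w)
height≡stackHeight end              = refl
height≡stackHeight {suc c} (down w) = cong₂ _⊔_ (sym (+-identityʳ (suc c))) (height≡stackHeight w)
height≡stackHeight {c} (up w)       = trans (cong (c ⊔_) (height≡stackHeight w)) (sym (stackHeight-merge c (stack w)))

module _ (n h : ℕ) where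

  TreesWith : (BTree → ℕ) → Set
  TreesWith f = Σ BTree (λ t → True ((internal t ≟ n) ×-dec (f t ≟ h)))

  private
    pathOf : (W : Walks 0) → proj₁ W ≡ 2 * n → stackHeight 0 (stackOf W) ≡ h → 𝒟 n h
    pathOf (_ , v , w) refl height≡ =
      mk𝒟 v (Equivalence.from (isDyck⇔walk n v) w) (trans (height≡stackHeight w) height≡)

    pathOf-path : ∀ W e height≡ {v : Vec ℕ (suc (2 * n))} {w : Walk 0 v} →
                  W ≡ (2 * n , v , w) → 𝒟.path (pathOf W e height≡) ≡ v
    pathOf-path _ e _ refl rewrite ≡-irrelevant e refl = refl

    -- The fields of 𝒟 are irrelevant; being decidable, the walk is recomputed from them.
    walk : (d : 𝒟 n h) → Walk 0 (𝒟.path d)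
    walk (mk𝒟 v isDyck _) = recompute (walk? 0 v) (Equivalence.to (isDyck⇔walk n v) isDyck)

    tree : 𝒟 n h → TreesWith leftDepth
    tree d@(mk𝒟 v _ height≡) = Vec.head (stack w) , fromWitness (internal≡ , leftDepth≡)
      where
      w = walk d
      internal≡ : internal (Vec.head (stack w)) ≡ n
      internal≡ with stack w | walk-length w
      ... | t ∷ [] | 2n≡ = sym (*-cancelˡ-≡ n _ 2 (trans 2n≡ (cong (2 *_) (+-identityʳ (internal t)))))
      leftDepth≡ : leftDepth (Vec.head (stack w)) ≡ h
      leftDepth≡ with stack w | height≡stackHeight w
      ... | t ∷ [] | height≡′ = trans (sym height≡′) (recompute (height v ≟ h) height≡)

    walkOf : TreesWith leftDepth → Walks 0
    walkOf (t , _) = unstack (t ∷ [])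

    walkOf-length : ∀ x → proj₁ (walkOf x) ≡ 2 * n
    walkOf-length (t , q) = begin
      proj₁ (unstack (t ∷ []))               ≡⟨ walk-length (proj₂ (proj₂ (unstack (t ∷ [])))) ⟩
      2 * size (stackOf (unstack (t ∷ [])))  ≡⟨ cong (λ ts → 2 * size ts) (stack-unstack (t ∷ [])) ⟩
      2 * (internal t + 0)                   ≡⟨ cong (2 *_) (trans (+-identityʳ (internal t)) (proj₁ (toWitness q))) ⟩
      2 * n                                  ∎
      where open ≡-Reasoning

    walkOf-height : ∀ x → stackHeight 0 (stackOf (walkOf x)) ≡ h
    walkOf-height (t , q) = trans (cong (stackHeight 0) (stack-unstack (t ∷ []))) (proj₂ (toWitness q))

    path : TreesWith leftDepth → 𝒟 n h
    path x = pathOf (walkOf x) (walkOf-length x) (walkOf-height x)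

    tree-pathOf : ∀ W e height≡ → proj₁ (tree (pathOf W e height≡)) ≡ Vec.head (stackOf W)
    tree-pathOf (_ , v , w) refl _ = cong (Vec.head ∘ stack) (walk-irrelevant (recompute (walk? 0 v) _) w)

    𝒟-≡ : ∀ {d d′ : 𝒟 n h} → 𝒟.path d ≡ 𝒟.path d′ → d ≡ d′
    𝒟-≡ {mk𝒟 _ _ _} {mk𝒟 _ _ _} refl = refl

    TreesWith-≡ : ∀ {x y : TreesWith leftDepth} → proj₁ x ≡ proj₁ y → x ≡ y
    TreesWith-≡ {t , _} {_ , _} refl = cong (t ,_) (T-irrelevant _ _)

    head∷[] : ∀ {A : Set} (xs : Vec A 1) → Vec.head xs ∷ [] ≡ xs
    head∷[] (_ ∷ []) = refl

  𝒟↔trees : 𝒟 n h ↔ TreesWith leftDepth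
  𝒟↔trees = mk↔ₛ′ tree path tree∘path path∘tree
    where
    tree∘path : ∀ x → tree (path x) ≡ x
    tree∘path x@(t , _) = TreesWith-≡ (trans (tree-pathOf (walkOf x) (walkOf-length x) (walkOf-height x))
                                              (cong Vec.head (stack-unstack (t ∷ []))))
    path∘tree : ∀ d → path (tree d) ≡ d
    path∘tree d = 𝒟-≡ (pathOf-path (walkOf (tree d)) (walkOf-length (tree d)) (walkOf-height (tree d))
                         (trans (cong unstack (head∷[] (stack (walk d)))) (unstack-stack (walk d))))

ℬ↔trees : ∀ n h → ℬ n h ↔ TreesWith n h strahler
ℬ↔trees n h = mk↔ₛ′ to from (λ (t , _) → cong (t ,_) (T-irrelevant _ _)) (λ _ → refl)
  where
  to : ℬ n h → TreesWith n h strahler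
  to (mkℬ t internal≡ strahler≡) =
    t , fromWitness (recompute (internal t ≟ n) internal≡ ,
                     recompute (strahler t ≟ h) (Equivalence.to (hasStrahler⇔ t h) strahler≡))
  from : TreesWith n h strahler → ℬ n h
  from (t , q) = mkℬ t (proj₁ (toWitness q)) (Equivalence.from (hasStrahler⇔ t h) (proj₂ (toWitness q)))

theorem1p1 : (n h : ℕ) → ℬ n h ↔ 𝒟 n h
theorem1p1 n h = begin
  ℬ n h                        ↔⟨ ℬ↔trees n h ⟩
  TreesWith n h strahler       ↔⟨ #↔Fin (λ t → strahler t ≟ h) n ⟩
  Fin (exactly strahler h n)   ≡⟨ cong Fin (exactly-strahler≗leftDepth h n) ⟩
  Fin (exactly leftDepth h n)  ↔⟨ #↔Fin (λ t → leftDepth t ≟ h) n ⟨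
  TreesWith n h leftDepth      ↔⟨ 𝒟↔trees n h ⟨
  𝒟 n h                        ∎
  where open Related.EquationalReasoning
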